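{- Let $n\ge 3$, let $X$ be any triplet over $[n]$, let $T\in RP(n)$, and let $T'=\textsc{Add-Leaf}(T)$. Then $X$ is resolved in $T$ if and only if the quartet $X\cup\{n+1\}$ is resolved in $T'$.
   Context: $RP(n)$ is the set of rooted phylogenies over $[n]$ (rooted trees with leaf set $[n]$, every internal node with at least two children; resolved node: exactly two children). Unrooted phylogenies have internal nodes of degree at least $3$, resolved if degree $3$. $\textsc{Add-Leaf}(T)$ is the unrooted tree obtained from $T\in RP(n)$ by attaching a new leaf labeled $n+1$ as a child of the root of $T$ and then forgetting the root. For $X$ a subset of the leaves, $T|X$ is obtained from the minimal subtree containing $X$ by suppressing degree-two nodes (except the root in the rooted case); a triplet (3-subset) or quartet (4-subset) $X$ is resolved in $T$ if $T|X$ is fully resolved (all internal nodes resolved). -}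

module Defs where

open import Data.Nat using (ℕ; suc; _≤_)
open import Data.Fin using (Fin; inject₁; fromℕ)
open import Data.Fin.Subset using (Subset; inside)
open import Data.Bool using (Bool; true; false; if_then_else_)
open import Data.List using (List; []; _∷_; _++_; [_]; allFin; length)
open import Data.List.Relation.Unary.All using (All)
open import Data.List.Relation.Binary.Permutation.Propositional using (_↭_)
open import Data.Maybe using (Maybe; just; nothing)
open import Data.Vec using (lookup)
open import Data.Product using (Σ; _×_)
open import Relation.Binary.PropositionalEquality using (_≡_)

-- Trees (rose trees with labelled leaves).  A rooted phylogeny is such a
-- tree; the order of children is irrelevant for everything below.

data Tree (L : Set) : Set where
  leaf : L → Tree L
  node : List (Tree L) → Tree L

mutual
  leaves : {L : Set} → Tree L → List L
  leaves (leaf a)  = [ a ]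
  leaves (node ts) = leavesList ts

  leavesList : {L : Set} → List (Tree L) → List L
  leavesList []       = []
  leavesList (t ∷ ts) = leaves t ++ leavesList ts

mutual
  relabel : {A B : Set} → (A → B) → Tree A → Tree B
  relabel f (leaf a)  = leaf (f a)
  relabel f (node ts) = node (relabelList f ts)

  relabelList : {A B : Set} → (A → B) → List (Tree A) → List (Tree B)
  relabelList f []       = []
  relabelList f (t ∷ ts) = relabel f t ∷ relabelList f ts

data AtLeast2 {L : Set} : Tree L → Set where
  leaf : ∀ a → AtLeast2 (leaf a)
  node : ∀ ts → 2 ≤ length ts → All AtLeast2 ts → AtLeast2 (node ts)

-- RP(n): rooted phylogenies over [n] (labels Fin n; label i stands for i+1);
-- every label occurs exactly once as a leaf.
IsRP : (n : ℕ) → Tree (Fin n) → Set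
IsRP n T = AtLeast2 T × (leaves T ↭ allFin n)

-- Restriction T|X: keep the minimal subtree spanned by the leaves in X
-- (hung at its topmost vertex, i.e. the lca of X), suppressing the
-- vertices left with a single child.

mutual
  restrict : {n : ℕ} → Subset n → Tree (Fin n) → Maybe (Tree (Fin n))
  restrict X (leaf a)  = if lookup X a then just (leaf a) else nothing
  restrict X (node ts) with restrictList X ts
  ... | []          = nothing
  ... | (t ∷ [])    = just t
  ... | (t ∷ u ∷ us) = just (node (t ∷ u ∷ us))

  restrictList : {n : ℕ} → Subset n → List (Tree (Fin n)) → List (Tree (Fin n))
  restrictList X []       = []
  restrictList X (t ∷ ts) with restrict X t
  ... | nothing = restrictList X ts
  ... | just t' = t' ∷ restrictList X ts

data Binary {L : Set} : Tree L → Set where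
  leaf : ∀ a → Binary (leaf a)
  node : ∀ {l r} → Binary l → Binary r → Binary (node (l ∷ r ∷ []))

ResolvedR : {n : ℕ} → Subset n → Tree (Fin n) → Set
ResolvedR {n} X T = Σ (Tree (Fin n)) λ t → (restrict X T ≡ just t) × Binary t

-- Unrooted trees are represented by a rose tree hung at some vertex
-- (the "root" of the representation carries no meaning).  In this
-- representation the unrooted degree of the hanging vertex is its number
-- of children, and that of any other internal vertex is its number of
-- children plus one.

-- Add-Leaf: attach leaf n+1 (= fromℕ n) as a child of the root, then
-- read the result as an unrooted tree (hung at the former root).
addLeaf : {n : ℕ} → Tree (Fin n) → Tree (Fin (suc n))
addLeaf {n} (leaf a)  = node (leaf (inject₁ a) ∷ leaf (fromℕ n) ∷ [])
addLeaf {n} (node ts) = node (relabelList inject₁ ts ++ [ leaf (fromℕ n) ])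

-- An unrooted tree (hung at a vertex, restricted as above) is fully
-- resolved iff every internal vertex has degree exactly 3.  The
-- restriction is hung at a vertex having ≥ 2 children; if it has exactly
-- 2 it has degree 2 and is suppressed, otherwise it must have degree 3.
-- All other internal vertices must have 2 children (degree 3).
data FullyResolvedU {L : Set} : Tree L → Set where
  deg2 : ∀ {a b} → Binary a → Binary b → FullyResolvedU (node (a ∷ b ∷ []))
  deg3 : ∀ {a b c} → Binary a → Binary b → Binary c →
         FullyResolvedU (node (a ∷ b ∷ c ∷ []))

ResolvedU : {n : ℕ} → Subset n → Tree (Fin n) → Set
ResolvedU {n} X T = Σ (Tree (Fin n)) λ t → (restrict X T ≡ just t) × FullyResolvedU t

-- Grafting leaf n+1 at the root only appends a leaf to the children of the
-- root, and restriction to X ∪ {n+1} commutes with this: if the restriction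
-- of T to X has root children ts, then that of T′ has root children ts
-- followed by the leaf n+1, all deeper vertices being shared.  Hence T|X is
-- binary (ts = [t] or [t, u] with t, u binary) exactly when the hanging
-- vertex of T′|(X ∪ {n+1}) has two or three children, all binary.
module Submission where

open import Defs
open import Data.Nat using (ℕ; _≤_)
open import Data.Fin using (Fin; zero; suc; inject₁; fromℕ)
open import Data.Fin.Subset using (Subset; ∣_∣)
open import Data.Bool using (true; false)
open import Data.Vec using (_∷_; []; _∷ʳ_; lookup)
open import Data.List using (List; []; _∷_; _++_; [_])
open import Data.Maybe using (Maybe; just; nothing)
import Data.Maybe as Maybe
open import Data.Product using (Σ; _×_; _,_)
open import Data.Empty using (⊥-elim)
open import Relation.Nullary using (¬_)
open import Function.Bundles using (_⇔_; mk⇔; Equivalence)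
open import Relation.Binary.PropositionalEquality using (_≡_; refl; sym; cong; cong₂; subst₂)
open Relation.Binary.PropositionalEquality.≡-Reasoning

lookup-∷ʳ-inject₁ : ∀ {n} (X : Subset n) (a : Fin n) → lookup (X ∷ʳ true) (inject₁ a) ≡ lookup X a
lookup-∷ʳ-inject₁ (x ∷ X) zero    = refl
lookup-∷ʳ-inject₁ (x ∷ X) (suc a) = lookup-∷ʳ-inject₁ X a

lookup-∷ʳ-fromℕ : ∀ {n} (X : Subset n) → lookup (X ∷ʳ true) (fromℕ n) ≡ true
lookup-∷ʳ-fromℕ []      = refl
lookup-∷ʳ-fromℕ (x ∷ X) = lookup-∷ʳ-fromℕ X

-- The restriction of a tree, given the restrictions of the children of its root.
hang : ∀ {L : Set} → List (Tree L) → Maybe (Tree L)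
hang []           = nothing
hang (t ∷ [])     = just t
hang (t ∷ u ∷ us) = just (node (t ∷ u ∷ us))

-- A leaf is treated as its own only child, so that addLeaf T is always a node.
children : ∀ {L : Set} → Tree L → List (Tree L)
children (leaf a)  = [ leaf a ]
children (node ts) = ts

addLeaf-children : ∀ {n} (T : Tree (Fin n)) →
                   addLeaf T ≡ node (relabelList inject₁ (children T) ++ [ leaf (fromℕ n) ])
addLeaf-children (leaf a)  = refl
addLeaf-children (node ts) = refl

restrict-node : ∀ {n} (X : Subset n) ts → restrict X (node ts) ≡ hang (restrictList X ts)
restrict-node X ts with restrictList X ts
... | []         = refl
... | _ ∷ []     = refl
... | _ ∷ _ ∷ _  = refl

restrict-children : ∀ {n} (X : Subset n) T → restrict X T ≡ hang (restrictList X (children T))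
restrict-children X (leaf a) with lookup X a
... | true  = refl
... | false = refl
restrict-children X (node ts) = restrict-node X ts

restrictList-++ : ∀ {n} (X : Subset n) ts us →
                  restrictList X (ts ++ us) ≡ restrictList X ts ++ restrictList X us
restrictList-++ X []       us = refl
restrictList-++ X (t ∷ ts) us with restrict X t
... | nothing = restrictList-++ X ts us
... | just t′ = cong (t′ ∷_) (restrictList-++ X ts us)

mutual
  restrict-relabel : ∀ {n} (X : Subset n) t →
                     restrict (X ∷ʳ true) (relabel inject₁ t) ≡ Maybe.map (relabel inject₁) (restrict X t)
  restrict-relabel X (leaf a) rewrite lookup-∷ʳ-inject₁ X a with lookup X a
  ... | true  = refl
  ... | false = refl
  restrict-relabel X (node ts) = begin
    restrict (X ∷ʳ true) (node (relabelList inject₁ ts))    ≡⟨ restrict-node (X ∷ʳ true) (relabelList inject₁ ts) ⟩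
    hang (restrictList (X ∷ʳ true) (relabelList inject₁ ts)) ≡⟨ cong hang (restrictList-relabelList X ts) ⟩
    hang (relabelList inject₁ (restrictList X ts))           ≡⟨ hang-relabelList (restrictList X ts) ⟩
    Maybe.map (relabel inject₁) (hang (restrictList X ts))   ≡⟨ cong (Maybe.map _) (sym (restrict-node X ts)) ⟩
    Maybe.map (relabel inject₁) (restrict X (node ts))       ∎
    where
    hang-relabelList : ∀ us → hang (relabelList inject₁ us) ≡ Maybe.map (relabel inject₁) (hang us)
    hang-relabelList []          = refl
    hang-relabelList (_ ∷ [])    = refl
    hang-relabelList (_ ∷ _ ∷ _) = refl

  restrictList-relabelList : ∀ {n} (X : Subset n) ts →
                             restrictList (X ∷ʳ true) (relabelList inject₁ ts) ≡
                             relabelList inject₁ (restrictList X ts)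
  restrictList-relabelList X []       = refl
  restrictList-relabelList X (t ∷ ts) rewrite restrict-relabel X t with restrict X t
  ... | nothing = restrictList-relabelList X ts
  ... | just t′ = cong (relabel inject₁ t′ ∷_) (restrictList-relabelList X ts)

restrict-addLeaf : ∀ {n} (X : Subset n) T →
                   restrict (X ∷ʳ true) (addLeaf T) ≡
                   hang (relabelList inject₁ (restrictList X (children T)) ++ [ leaf (fromℕ n) ])
restrict-addLeaf {n} X T = begin
  restrict X′ (addLeaf T)
    ≡⟨ cong (restrict X′) (addLeaf-children T) ⟩
  restrict X′ (node (relabelList inject₁ (children T) ++ [ leaf (fromℕ n) ]))
    ≡⟨ restrict-node X′ (relabelList inject₁ (children T) ++ [ leaf (fromℕ n) ]) ⟩
  hang (restrictList X′ (relabelList inject₁ (children T) ++ [ leaf (fromℕ n) ]))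
    ≡⟨ cong hang (restrictList-++ X′ (relabelList inject₁ (children T)) _) ⟩
  hang (restrictList X′ (relabelList inject₁ (children T)) ++ restrictList X′ [ leaf (fromℕ n) ])
    ≡⟨ cong₂ (λ ts us → hang (ts ++ us)) (restrictList-relabelList X (children T)) restrictList-new ⟩
  hang (relabelList inject₁ (restrictList X (children T)) ++ [ leaf (fromℕ n) ]) ∎
  where
  X′ = X ∷ʳ true
  restrictList-new : restrictList X′ [ leaf (fromℕ n) ] ≡ [ leaf (fromℕ n) ]
  restrictList-new rewrite lookup-∷ʳ-fromℕ X = refl

Binary-relabel : ∀ {A B : Set} (f : A → B) {t} → Binary t → Binary (relabel f t)
Binary-relabel f (leaf a)   = leaf (f a)
Binary-relabel f (node l r) = node (Binary-relabel f l) (Binary-relabel f r)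

Binary-unrelabel : ∀ {A B : Set} (f : A → B) t → Binary (relabel f t) → Binary t
Binary-unrelabel f (leaf a)               _            = leaf a
Binary-unrelabel f (node (l ∷ r ∷ [])) (node bl br) =
  node (Binary-unrelabel f l bl) (Binary-unrelabel f r br)

ResolvedBy : ∀ {L : Set} → (Tree L → Set) → Maybe (Tree L) → Set
ResolvedBy {L} P m = Σ (Tree L) λ t → (m ≡ just t) × P t

binary⇔fullyResolvedU-graft : ∀ {A B : Set} (f : A → B) (b : B) (ts : List (Tree A)) →
  ResolvedBy Binary (hang ts) ⇔ ResolvedBy FullyResolvedU (hang (relabelList f ts ++ [ leaf b ]))
binary⇔fullyResolvedU-graft f b []                = mk⇔ (λ { (_ , () , _) }) (λ { (_ , refl , ()) })
binary⇔fullyResolvedU-graft f b (t ∷ [])          = mk⇔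
  (λ { (_ , refl , bt) → _ , refl , deg2 (Binary-relabel f bt) (leaf b) })
  (λ { (_ , refl , deg2 bt _) → _ , refl , Binary-unrelabel f t bt })
binary⇔fullyResolvedU-graft f b (t ∷ u ∷ [])      = mk⇔
  (λ { (_ , refl , node bt bu) → _ , refl , deg3 (Binary-relabel f bt) (Binary-relabel f bu) (leaf b) })
  (λ { (_ , refl , deg3 bt bu _) → _ , refl , node (Binary-unrelabel f t bt) (Binary-unrelabel f u bu) })
binary⇔fullyResolvedU-graft f b (t ∷ u ∷ v ∷ ts) = mk⇔
  (λ { (_ , refl , ()) })
  (λ { (_ , refl , r) → ⊥-elim (¬FullyResolvedU-4 (relabelList f ts) r) })
  where
  ¬FullyResolvedU-4 : ∀ {L : Set} {x y z w : Tree L} ws → ¬ FullyResolvedU (node (x ∷ y ∷ z ∷ ws ++ [ w ]))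
  ¬FullyResolvedU-4 []      ()
  ¬FullyResolvedU-4 (_ ∷ _) ()

lemma4 : (n : ℕ) → 3 ≤ n → (X : Subset n) → ∣ X ∣ ≡ 3 →
         (T : Tree (Fin n)) → IsRP n T →
         ((ResolvedR X T → ResolvedU (X ∷ʳ true) (addLeaf T)) ×
          (ResolvedU (X ∷ʳ true) (addLeaf T) → ResolvedR X T))
lemma4 n _ X _ T _ = Equivalence.to resolved⇔ , Equivalence.from resolved⇔
  where
  resolved⇔ : ResolvedR X T ⇔ ResolvedU (X ∷ʳ true) (addLeaf T)
  resolved⇔ = subst₂ (λ m m′ → ResolvedBy Binary m ⇔ ResolvedBy FullyResolvedU m′)
                     (sym (restrict-children X T)) (sym (restrict-addLeaf X T))
                     (binary⇔fullyResolvedU-graft inject₁ (fromℕ n) (restrictList X (children T)))
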